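{- Let $X$ be a finite set of items, each with a cost in $(0,B]$. Let $S^1,\dots,S^{m}$ be the blocks produced by First-Fit Decreasing on $X$, and let $T^1,\dots,T^{OPT}$ be the blocks of a partition of $X$ into the minimum possible number $OPT$ of blocks. If there exist $i$ and $j$ with $cost(S^i)>cost(T^j)$, then $m\le\frac32 OPT-\frac12$.
   Context: A block is a set of items whose total cost (sum of costs of its items) is at most $B$; $cost(S)$ denotes the total cost of $S$. First-Fit Decreasing (FFD): sort the items in non-increasing order of cost; process them in this order, placing each item into the lowest-indexed existing block to which it can be added without the total cost exceeding $B$, and opening a new block containing it if no such block exists.
   Formalization: The item costs and the bound B are rational numbers rather than real ones. -}

module Defs where

open import Data.List using (List; []; _∷_; foldr; foldl; length; concat)
open import Data.List.Relation.Unary.All using (All)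
open import Data.List.Relation.Unary.Linked using (Linked)
open import Data.List.Relation.Binary.Permutation.Propositional using (_↭_)
open import Data.Rational using (ℚ; 0ℚ; _+_; _≤_; _≥_)
open import Data.Rational.Properties using (_≤?_)
open import Data.Product using (_×_)
open import Data.Nat as ℕ using (ℕ)
open import Relation.Nullary using (yes; no)

cost : List ℚ → ℚ
cost = foldr _+_ 0ℚ

Feasible : ℚ → List (List ℚ) → Set
Feasible B Ts = All (λ T → cost T ≤ B) Ts

IsPartition : ℚ → List ℚ → List (List ℚ) → Set
IsPartition B X Ts = (concat Ts ↭ X) × Feasible B Ts

IsOptimalPartition : ℚ → List ℚ → List (List ℚ) → Set
IsOptimalPartition B X Ts =
  IsPartition B X Ts × (∀ Us → IsPartition B X Us → length Ts ℕ.≤ length Us)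

ffInsert : ℚ → ℚ → List (List ℚ) → List (List ℚ)
ffInsert B c [] = (c ∷ []) ∷ []
ffInsert B c (S ∷ Ss) with (cost S + c) ≤? B
... | yes _ = (c ∷ S) ∷ Ss
... | no _  = S ∷ ffInsert B c Ss

firstFit : ℚ → List ℚ → List (List ℚ)
firstFit B = foldl (λ Ss c → ffInsert B c Ss) []

SortedDecreasing : List ℚ → List ℚ → Set
SortedDecreasing X ys = (ys ↭ X) × Linked _≥_ ys

-- Let y be the item that opened the last block of First-Fit Decreasing. When y
-- was packed, every earlier block held only items of cost ≥ y and could not
-- take y; this stays true of the items of cost ≥ y in the final blocks, since
-- later insertions only add to them.
--
-- If 3y > B, give each item x ≥ y weight 2 when x + y > B and weight 1
-- otherwise. Every FFD block but the last weighs at least 2 and the last at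
-- least 1, while a block of capacity B holds at most two items ≥ y and weighs
-- at most 2. Hence 2m − 1 ≤ 2·OPT, i.e. m ≤ OPT.
--
-- If 3y ≤ B, every FFD block but the last costs more than B − y ≥ 2B/3, and the
-- last block together with any other one costs more than B. The total cost is
-- at most (OPT − 1)B + cost(T^j) < (OPT − 1)B + cost(S^i), so the blocks other
-- than S^i cost less than (OPT − 1)B, which forces 2m < 3·OPT.

module Submission where

open import Defs
import Algebra.Properties.CommutativeMonoid.Mult as Mult
open import Data.Bool using (true; false; if_then_else_)
open import Data.Empty using (⊥-elim)
open import Data.List using (List; []; _∷_; _++_; [_]; length; concat; map; filter; foldl)
open import Data.List.Membership.Propositional using (_∈_)
open import Data.List.Membership.Propositional.Properties
  using (∈-∃++; ∈-++⁻; ∈-++⁺ʳ; ∈-filter⁺; ∈-concat⁺′)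
import Data.List.Properties as List
open import Data.List.Relation.Binary.Permutation.Propositional
  using (_↭_; prep; ↭-refl; ↭-sym; ↭-trans; ↭-reflexive; ↭⇒↭ₛ; module PermutationReasoning)
open import Data.List.Relation.Binary.Permutation.Propositional.Properties
  using (All-resp-↭; ∈-resp-↭; shift; ++⁺ˡ; ++⁺ʳ; ↭-length; ∷↭∷ʳ; filter-↭)
  renaming (map⁺ to ↭-map⁺)
open import Data.List.Relation.Binary.Permutation.Setoid.Properties using (foldr-commMonoid)
open import Data.List.Relation.Binary.Sublist.Propositional using (_⊆_; []; _∷_; _∷ʳ_; from∈)
open import Data.List.Relation.Binary.Sublist.Propositional.Properties using (filter-⊆)
open import Data.List.Relation.Unary.All as All using (All; []; _∷_)
open import Data.List.Relation.Unary.All.Properties using (all-filter; concat⁻; ++⁻)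
open import Data.List.Relation.Unary.AllPairs using (AllPairs; []; _∷_)
open import Data.List.Relation.Unary.Any using (here; there)
open import Data.List.Relation.Unary.Linked using (Linked)
open import Data.List.Relation.Unary.Linked.Properties using (Linked⇒AllPairs)
open import Data.Nat as ℕ using (ℕ; zero; suc; z≤n; s≤s)
open import Data.Nat.ListAction using (sum)
open import Data.Nat.ListAction.Properties using (sum-++; sum-↭)
import Data.Nat.Properties as ℕₚ
open import Data.Nat.Tactic.RingSolver using (solve-∀)
open import Data.Product using (_×_; ∃-syntax; _,_; proj₁; proj₂)
open import Data.Rational using (ℚ; 0ℚ; _<_; _≤_; _≥_; _+_)
import Data.Rational.Properties as ℚₚ
open import Data.Rational.Solver using (module +-*-Solver)
open import Data.Sum using (_⊎_; inj₁; inj₂; [_,_]′)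
open import Function using (_∘_)
open import Relation.Binary.PropositionalEquality
  using (_≡_; refl; sym; trans; cong; cong₂; subst; setoid; module ≡-Reasoning)
open import Relation.Nullary using (¬_; Dec; yes; no; does)
open import Relation.Nullary.Decidable using (dec-true; dec-false)

open Mult ℚₚ.+-0-commutativeMonoid using (×-assocˡ; ×-distrib-+) renaming (_×_ to _·_)
open +-*-Solver using (solve; _:+_; _:=_; con)

<⇒≱ : ∀ {a b} → a < b → ¬ (b ≤ a)
<⇒≱ a<b b≤a = ℚₚ.<-irrefl refl (ℚₚ.<-≤-trans a<b b≤a)

+-cancelˡ-< : ∀ c {a b} → c + a < c + b → a < b
+-cancelˡ-< c {a} {b} lt with a ℚₚ.<? b
... | yes a<b = a<b
... | no a≮b  = ⊥-elim (<⇒≱ lt (ℚₚ.+-monoʳ-≤ c (ℚₚ.≮⇒≥ a≮b)))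

·-nonneg : ∀ n {x} → 0ℚ ≤ x → 0ℚ ≤ n · x
·-nonneg zero    _   = ℚₚ.≤-refl
·-nonneg (suc n) x≥0 = ℚₚ.+-mono-≤ x≥0 (·-nonneg n x≥0)

·-monoˡ-≤ : ∀ {m n x} → 0ℚ ≤ x → m ℕ.≤ n → m · x ≤ n · x
·-monoˡ-≤ {n = n} x≥0 z≤n       = ·-nonneg n x≥0
·-monoˡ-≤ {x = x} x≥0 (s≤s m≤n) = ℚₚ.+-monoʳ-≤ x (·-monoˡ-≤ x≥0 m≤n)

·-cancelˡ-< : ∀ {m n x} → 0ℚ ≤ x → m · x < n · x → m ℕ.< n
·-cancelˡ-< {m} {n} x≥0 lt with m ℕ.<? n
... | yes m<n = m<n
... | no m≮n  = ⊥-elim (<⇒≱ lt (·-monoˡ-≤ x≥0 (ℕₚ.≮⇒≥ m≮n)))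

·-monoʳ-≤ : ∀ n {x z} → x ≤ z → n · x ≤ n · z
·-monoʳ-≤ zero    _   = ℚₚ.≤-refl
·-monoʳ-≤ (suc n) x≤z = ℚₚ.+-mono-≤ x≤z (·-monoʳ-≤ n x≤z)

·-monoʳ-< : ∀ n {x z} → x < z → suc n · x < suc n · z
·-monoʳ-< n x<z = ℚₚ.+-mono-<-≤ x<z (·-monoʳ-≤ n (ℚₚ.<⇒≤ x<z))

cost-++ : ∀ xs ys → cost (xs ++ ys) ≡ cost xs + cost ys
cost-++ []       ys = sym (ℚₚ.+-identityˡ (cost ys))
cost-++ (x ∷ xs) ys = trans (cong (x +_) (cost-++ xs ys)) (sym (ℚₚ.+-assoc x (cost xs) (cost ys)))

cost-↭ : ∀ {xs ys} → xs ↭ ys → cost xs ≡ cost ys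
cost-↭ p = foldr-commMonoid (setoid ℚ) ℚₚ.+-0-isCommutativeMonoid (↭⇒↭ₛ p)

cost-nonneg : ∀ {xs} → All (0ℚ ≤_) xs → 0ℚ ≤ cost xs
cost-nonneg []           = ℚₚ.≤-refl
cost-nonneg (x≥0 ∷ xs≥0) = ℚₚ.+-mono-≤ x≥0 (cost-nonneg xs≥0)

cost-mono-⊆ : ∀ {xs ys} → All (0ℚ ≤_) ys → xs ⊆ ys → cost xs ≤ cost ys
cost-mono-⊆ []           []           = ℚₚ.≤-refl
cost-mono-⊆ (y≥0 ∷ ys≥0) (y ∷ʳ xs⊆ys) =
  subst (_≤ y + _) (ℚₚ.+-identityˡ _) (ℚₚ.+-mono-≤ y≥0 (cost-mono-⊆ ys≥0 xs⊆ys))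
cost-mono-⊆ {x ∷ _} (_ ∷ ys≥0) (refl ∷ xs⊆ys) = ℚₚ.+-monoʳ-≤ x (cost-mono-⊆ ys≥0 xs⊆ys)

∈⇒≤cost : ∀ {x xs} → All (0ℚ ≤_) xs → x ∈ xs → x ≤ cost xs
∈⇒≤cost {x} xs≥0 x∈xs = subst (_≤ _) (ℚₚ.+-identityʳ x) (cost-mono-⊆ xs≥0 (from∈ x∈xs))

totalCost : List (List ℚ) → ℚ
totalCost Ds = cost (map cost Ds)

cost-concat : ∀ Ds → cost (concat Ds) ≡ totalCost Ds
cost-concat []       = refl
cost-concat (D ∷ Ds) = trans (cost-++ D (concat Ds)) (cong (cost D +_) (cost-concat Ds))

totalCost-↭ : ∀ {Ds Es} → Ds ↭ Es → totalCost Ds ≡ totalCost Es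
totalCost-↭ p = cost-↭ (↭-map⁺ cost p)

totalCost-≤ : ∀ {a Ds} → All (λ D → cost D ≤ a) Ds → totalCost Ds ≤ length Ds · a
totalCost-≤ []           = ℚₚ.≤-refl
totalCost-≤ (D≤a ∷ Ds≤a) = ℚₚ.+-mono-≤ D≤a (totalCost-≤ Ds≤a)

totalCost-≥ : ∀ {a n Ds} → All (λ D → a ≤ n · cost D) Ds → length Ds · a ≤ n · totalCost Ds
totalCost-≥ {n = n} []                     = ·-nonneg n ℚₚ.≤-refl
totalCost-≥ {n = n} {D ∷ Ds} (a≤D ∷ a≤Ds) =
  subst (_ ≤_) (sym (×-distrib-+ (cost D) (totalCost Ds) n))
    (ℚₚ.+-mono-≤ a≤D (totalCost-≥ {n = n} a≤Ds))

∈⇒↭∷ : ∀ {A : Set} {x : A} {xs} → x ∈ xs → ∃[ ys ] xs ↭ x ∷ ys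
∈⇒↭∷ x∈xs with ∈-∃++ x∈xs
... | ys , zs , refl = ys ++ zs , shift _ ys zs

totalCost-≤-∈ : ∀ {B T Ts} → Feasible B Ts → T ∈ Ts → totalCost Ts + B ≤ length Ts · B + cost T
totalCost-≤-∈ {B} {T} {Ts} feasible T∈Ts with ∈⇒↭∷ T∈Ts
... | Rest , Ts↭T∷Rest with All-resp-↭ Ts↭T∷Rest feasible
...   | _ ∷ feasibleRest = begin
  totalCost Ts + B                ≡⟨ cong (_+ B) (totalCost-↭ Ts↭T∷Rest) ⟩
  (cost T + totalCost Rest) + B   ≤⟨ ℚₚ.+-monoˡ-≤ B (ℚₚ.+-monoʳ-≤ (cost T) (totalCost-≤ feasibleRest)) ⟩
  (cost T + length Rest · B) + B  ≡⟨ solve 3 (λ t r b → (t :+ r) :+ b := (b :+ r) :+ t) refl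
                                       (cost T) (length Rest · B) B ⟩
  suc (length Rest) · B + cost T  ≡⟨ cong (λ n → n · B + cost T) (↭-length Ts↭T∷Rest) ⟨
  length Ts · B + cost T          ∎
  where open ℚₚ.≤-Reasoning

totalCost-rest-< : ∀ {B Ds Ts S T Rest} → Feasible B Ts → T ∈ Ts → totalCost Ds ≡ totalCost Ts →
                   cost T < cost S → Ds ↭ S ∷ Rest → totalCost Rest + B < length Ts · B
totalCost-rest-< {B} {Ds} {Ts} {S} {T} {Rest} feasible T∈Ts Ds≡Ts T<S Ds↭S∷Rest =
  +-cancelˡ-< (cost S) (begin-strict
    cost S + (totalCost Rest + B)  ≡⟨ ℚₚ.+-assoc (cost S) (totalCost Rest) B ⟨
    totalCost (S ∷ Rest) + B       ≡⟨ cong (_+ B) (totalCost-↭ Ds↭S∷Rest) ⟨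
    totalCost Ds + B               ≡⟨ cong (_+ B) Ds≡Ts ⟩
    totalCost Ts + B               ≤⟨ totalCost-≤-∈ feasible T∈Ts ⟩
    length Ts · B + cost T         <⟨ ℚₚ.+-monoʳ-< (length Ts · B) T<S ⟩
    length Ts · B + cost S         ≡⟨ ℚₚ.+-comm (length Ts · B) (cost S) ⟩
    cost S + length Ts · B         ∎)
  where open ℚₚ.≤-Reasoning

-- The First-Fit invariant

large : ℚ → List ℚ → List ℚ
large y = filter (y ℚₚ.≤?_)

cost-large≤cost : ∀ y {xs} → All (0ℚ ≤_) xs → cost (large y xs) ≤ cost xs
cost-large≤cost y {xs} xs≥0 = cost-mono-⊆ xs≥0 (filter-⊆ (y ℚₚ.≤?_) xs)

Rejects : ℚ → ℚ → List ℚ → Set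
Rejects B y S = B < cost (large y S) + y

Rejects-∷ : ∀ {B y c S} → 0ℚ ≤ c → Rejects B y S → Rejects B y (c ∷ S)
Rejects-∷ {B} {y} {c} {S} c≥0 rejects with y ℚₚ.≤? c
... | yes y≤c = ℚₚ.<-≤-trans rejects (ℚₚ.+-monoˡ-≤ y (begin
  cost (large y S)        ≡⟨ ℚₚ.+-identityˡ _ ⟨
  0ℚ + cost (large y S)   ≤⟨ ℚₚ.+-monoˡ-≤ _ c≥0 ⟩
  c + cost (large y S)    ≡⟨ cong cost (List.filter-accept (y ℚₚ.≤?_) y≤c) ⟨
  cost (large y (c ∷ S))  ∎))
  where open ℚₚ.≤-Reasoning
... | no y≰c = subst (λ S′ → B < cost S′ + y) (sym (List.filter-reject (y ℚₚ.≤?_) y≰c)) rejects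

overflow⇒Rejects : ∀ {B c S} → All (c ≤_) S → ¬ (cost S + c ≤ B) → Rejects B c S
overflow⇒Rejects {B} {c} c≤S overflow =
  subst (λ S′ → B < cost S′ + c) (sym (List.filter-all (c ℚₚ.≤?_) c≤S)) (ℚₚ.≰⇒> overflow)

Rejects⇒overflow : ∀ {B y S} → All (0ℚ ≤_) S → Rejects B y S → B < cost S + y
Rejects⇒overflow {y = y} S≥0 rejects =
  ℚₚ.<-≤-trans rejects (ℚₚ.+-monoˡ-≤ y (cost-large≤cost y S≥0))

data LastOpenedBy (B y : ℚ) : List (List ℚ) → Set where
  last : ∀ {L} → y ∈ L → LastOpenedBy B y (L ∷ [])
  _∷_  : ∀ {S Ss} → Rejects B y S → LastOpenedBy B y Ss → LastOpenedBy B y (S ∷ Ss)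

LastOpenedBy-split : ∀ {B y Ds} → LastOpenedBy B y Ds →
                     ∃[ NL ] ∃[ L ] (Ds ≡ NL ++ [ L ] × All (Rejects B y) NL × y ∈ L)
LastOpenedBy-split (last {L} y∈L) = [] , L , refl , [] , y∈L
LastOpenedBy-split (_∷_ {S} rejects opened) with LastOpenedBy-split opened
... | NL , L , refl , rejectsNL , y∈L = S ∷ NL , L , refl , rejects ∷ rejectsNL , y∈L

ffInsert-All : ∀ {P : ℚ → Set} B c Ss → P c → All (All P) Ss → All (All P) (ffInsert B c Ss)
ffInsert-All B c []       Pc []         = (Pc ∷ []) ∷ []
ffInsert-All B c (S ∷ Ss) Pc (PS ∷ PSs) with cost S + c ℚₚ.≤? B
... | yes _ = (Pc ∷ PS) ∷ PSs
... | no _  = PS ∷ ffInsert-All B c Ss Pc PSs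

concat-ffInsert : ∀ B c Ss → concat (ffInsert B c Ss) ↭ c ∷ concat Ss
concat-ffInsert B c []       = ↭-refl
concat-ffInsert B c (S ∷ Ss) with cost S + c ℚₚ.≤? B
... | yes _ = ↭-refl
... | no _  = ↭-trans (++⁺ˡ S (concat-ffInsert B c Ss)) (shift c S (concat Ss))

concat-foldl-ffInsert : ∀ B Ss zs → concat (foldl (λ Ss c → ffInsert B c Ss) Ss zs) ↭ zs ++ concat Ss
concat-foldl-ffInsert B Ss []       = ↭-refl
concat-foldl-ffInsert B Ss (z ∷ zs) = begin
  concat (foldl (λ Ss c → ffInsert B c Ss) (ffInsert B z Ss) zs)
    ↭⟨ concat-foldl-ffInsert B (ffInsert B z Ss) zs ⟩
  zs ++ concat (ffInsert B z Ss)
    ↭⟨ ++⁺ˡ zs (concat-ffInsert B z Ss) ⟩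
  zs ++ z ∷ concat Ss
    ↭⟨ shift z zs (concat Ss) ⟩
  z ∷ zs ++ concat Ss
    ∎
  where open PermutationReasoning

concat-firstFit : ∀ B ys → concat (firstFit B ys) ↭ ys
concat-firstFit B ys = ↭-trans (concat-foldl-ffInsert B [] ys) (↭-reflexive (List.++-identityʳ ys))

ffInsert-LastOpenedBy : ∀ {B y c Ss} → 0ℚ ≤ c → All (All (c ≤_)) Ss → LastOpenedBy B y Ss →
                        LastOpenedBy B y (ffInsert B c Ss) ⊎ LastOpenedBy B c (ffInsert B c Ss)
ffInsert-LastOpenedBy {B} {c = c} _ (c≤L ∷ []) (last {L} y∈L) with cost L + c ℚₚ.≤? B
... | yes _       = inj₁ (last (there y∈L))
... | no overflow = inj₂ (overflow⇒Rejects c≤L overflow ∷ last (here refl))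
ffInsert-LastOpenedBy {B} {c = c} c≥0 (c≤S ∷ c≤Ss) (_∷_ {S} rejects opened) with cost S + c ℚₚ.≤? B
... | yes _ = inj₁ (Rejects-∷ {S = S} c≥0 rejects ∷ opened)
... | no overflow with ffInsert-LastOpenedBy c≥0 c≤Ss opened
...   | inj₁ opened′ = inj₁ (rejects ∷ opened′)
...   | inj₂ opened′ = inj₂ (overflow⇒Rejects c≤S overflow ∷ opened′)

FirstFitState : ℚ → List (List ℚ) → Set
FirstFitState B Ss = Ss ≡ [] ⊎ ∃[ y ] LastOpenedBy B y Ss

ffInsert-state : ∀ {B c Ss} → 0ℚ ≤ c → All (All (c ≤_)) Ss → FirstFitState B Ss →
                 ∃[ y ] LastOpenedBy B y (ffInsert B c Ss)
ffInsert-state {c = c} _   _    (inj₁ refl)         = c , last (here refl)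
ffInsert-state {c = c} c≥0 c≤Ss (inj₂ (y , opened)) =
  [ (y ,_) , (c ,_) ]′ (ffInsert-LastOpenedBy c≥0 c≤Ss opened)

foldl-ffInsert-state : ∀ {B} Ss zs → All (0ℚ ≤_) zs → AllPairs _≥_ zs →
                       All (λ z → All (All (z ≤_)) Ss) zs →
                       FirstFitState B Ss → FirstFitState B (foldl (λ Ss c → ffInsert B c Ss) Ss zs)
foldl-ffInsert-state Ss [] _ _ _ state = state
foldl-ffInsert-state {B} Ss (z ∷ zs) (z≥0 ∷ zs≥0) (z≥zs ∷ sorted) (z≤Ss ∷ zs≤Ss) state =
  foldl-ffInsert-state (ffInsert B z Ss) zs zs≥0 sorted
    (All.zipWith (λ (z′≤z , z′≤Ss) → ffInsert-All B z Ss z′≤z z′≤Ss) (z≥zs , zs≤Ss))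
    (inj₂ (ffInsert-state z≥0 z≤Ss state))

firstFit-shape : ∀ {B ys S} → All (0ℚ ≤_) ys → Linked _≥_ ys → S ∈ firstFit B ys →
                 ∃[ y ] ∃[ NL ] ∃[ L ] (firstFit B ys ≡ NL ++ [ L ] × All (Rejects B y) NL × y ∈ L)
firstFit-shape {B} {ys} {S} ys≥0 sorted S∈D
  with foldl-ffInsert-state {B} [] ys ys≥0 (Linked⇒AllPairs (λ x≥y y≥z → ℚₚ.≤-trans y≥z x≥y) sorted)
         (All.universal (λ _ → []) ys) (inj₁ refl)
... | inj₂ (y , opened) = y , LastOpenedBy-split opened
... | inj₁ D≡[] with subst (S ∈_) D≡[] S∈D
...   | ()

-- Opener larger than B/3: weights

itemWeight : ℚ → ℚ → ℚ → ℕ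
itemWeight B y x = if does (x + y ℚₚ.≤? B) then 1 else 2

weight : ℚ → ℚ → List ℚ → ℕ
weight B y xs = sum (map (itemWeight B y) (large y xs))

itemWeight-fits : ∀ {B y x} → x + y ≤ B → itemWeight B y x ≡ 1
itemWeight-fits {B} {y} {x} fits = cong (if_then 1 else 2) (dec-true (x + y ℚₚ.≤? B) fits)

itemWeight-overflows : ∀ {B y x} → ¬ (x + y ≤ B) → itemWeight B y x ≡ 2
itemWeight-overflows {B} {y} {x} overflow =
  cong (if_then 1 else 2) (dec-false (x + y ℚₚ.≤? B) overflow)

1≤itemWeight : ∀ B y x → 1 ℕ.≤ itemWeight B y x
1≤itemWeight B y x = 1≤if (does (x + y ℚₚ.≤? B))
  where 1≤if : ∀ b → 1 ℕ.≤ (if b then 1 else 2)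
        1≤if true  = s≤s z≤n
        1≤if false = s≤s z≤n

itemWeight≤2 : ∀ B y x → itemWeight B y x ℕ.≤ 2
itemWeight≤2 B y x = if≤2 (does (x + y ℚₚ.≤? B))
  where if≤2 : ∀ b → (if b then 1 else 2) ℕ.≤ 2
        if≤2 true  = s≤s z≤n
        if≤2 false = ℕₚ.≤-refl

weight-++ : ∀ B y xs ys → weight B y (xs ++ ys) ≡ weight B y xs ℕ.+ weight B y ys
weight-++ B y xs ys = begin
  sum (map w (large y (xs ++ ys)))                ≡⟨ cong (sum ∘ map w) (List.filter-++ (y ℚₚ.≤?_) xs ys) ⟩
  sum (map w (large y xs ++ large y ys))          ≡⟨ cong sum (List.map-++ w (large y xs) (large y ys)) ⟩
  sum (map w (large y xs) ++ map w (large y ys))  ≡⟨ sum-++ (map w (large y xs)) (map w (large y ys)) ⟩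
  weight B y xs ℕ.+ weight B y ys                 ∎
  where open ≡-Reasoning
        w = itemWeight B y

weight-↭ : ∀ B y {xs ys} → xs ↭ ys → weight B y xs ≡ weight B y ys
weight-↭ B y p = sum-↭ (↭-map⁺ (itemWeight B y) (filter-↭ (y ℚₚ.≤?_) p))

weight-concat : ∀ B y Ds → weight B y (concat Ds) ≡ sum (map (weight B y) Ds)
weight-concat B y []       = refl
weight-concat B y (D ∷ Ds) =
  trans (weight-++ B y D (concat Ds)) (cong (weight B y D ℕ.+_) (weight-concat B y Ds))

sum-itemWeight≤2 : ∀ {B y xs} → B < 3 · y → 0ℚ ≤ y → All (y ≤_) xs → cost xs ≤ B →
                   sum (map (itemWeight B y) xs) ℕ.≤ 2
sum-itemWeight≤2 _ _ [] _ = z≤n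
sum-itemWeight≤2 {B} {y} {x ∷ []} _ _ _ _ =
  subst (ℕ._≤ 2) (sym (ℕₚ.+-identityʳ _)) (itemWeight≤2 B y x)
sum-itemWeight≤2 {B} {y} {x ∷ x′ ∷ []} _ _ (y≤x ∷ y≤x′ ∷ []) fits =
  ℕₚ.≤-reflexive (cong₂ (λ w w′ → w ℕ.+ (w′ ℕ.+ 0))
    (itemWeight-fits {B} {y} {x} (ℚₚ.≤-trans (ℚₚ.+-monoʳ-≤ x y≤x′) pair-fits))
    (itemWeight-fits {B} {y} {x′}
      (ℚₚ.≤-trans (ℚₚ.+-monoʳ-≤ x′ y≤x) (subst (_≤ B) (ℚₚ.+-comm x x′) pair-fits))))
  where pair-fits : x + x′ ≤ B
        pair-fits = subst (λ t → x + t ≤ B) (ℚₚ.+-identityʳ x′) fits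
sum-itemWeight≤2 {B} {y} {x ∷ x′ ∷ x″ ∷ xs} B<3y y≥0 (y≤x ∷ y≤x′ ∷ y≤x″ ∷ y≤xs) fits =
  ⊥-elim (<⇒≱ B<3y (ℚₚ.≤-trans 3y≤cost fits))
  where 3y≤cost : 3 · y ≤ cost (x ∷ x′ ∷ x″ ∷ xs)
        3y≤cost = ℚₚ.+-mono-≤ y≤x (ℚₚ.+-mono-≤ y≤x′ (ℚₚ.+-mono-≤ y≤x″
                    (cost-nonneg (All.map (ℚₚ.≤-trans y≥0) y≤xs))))

2≤sum-itemWeight : ∀ {B y xs} → y ≤ B → B < cost xs + y → 2 ℕ.≤ sum (map (itemWeight B y) xs)
2≤sum-itemWeight {B} {y} {[]} y≤B B<y = ⊥-elim (<⇒≱ (subst (B <_) (ℚₚ.+-identityˡ y) B<y) y≤B)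
2≤sum-itemWeight {B} {y} {x ∷ []} _ B<x+y =
  ℕₚ.≤-reflexive (sym (trans (ℕₚ.+-identityʳ _) (itemWeight-overflows {B} {y} {x} (<⇒≱ B<x+y′))))
  where B<x+y′ = subst (λ t → B < t + y) (ℚₚ.+-identityʳ x) B<x+y
2≤sum-itemWeight {B} {y} {x ∷ x′ ∷ _} _ _ =
  ℕₚ.+-mono-≤ (1≤itemWeight B y x) (ℕₚ.≤-trans (1≤itemWeight B y x′) (ℕₚ.m≤m+n _ _))

1≤sum-itemWeight : ∀ {B y x xs} → x ∈ xs → 1 ℕ.≤ sum (map (itemWeight B y) xs)
1≤sum-itemWeight {B} {y} {xs = x ∷ _} _ = ℕₚ.≤-trans (1≤itemWeight B y x) (ℕₚ.m≤m+n _ _)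

weight≤2 : ∀ {B y T} → B < 3 · y → 0ℚ ≤ y → All (0ℚ ≤_) T → cost T ≤ B → weight B y T ℕ.≤ 2
weight≤2 {y = y} {T} B<3y y≥0 T≥0 T≤B =
  sum-itemWeight≤2 B<3y y≥0 (all-filter (y ℚₚ.≤?_) T) (ℚₚ.≤-trans (cost-large≤cost y T≥0) T≤B)

length*2<sum-weight : ∀ {B y NL L} → y ≤ B → All (Rejects B y) NL → y ∈ L →
                      length NL ℕ.* 2 ℕ.< sum (map (weight B y) (NL ++ [ L ]))
length*2<sum-weight {B} {y} _ [] y∈L =
  ℕₚ.≤-trans (1≤sum-itemWeight {B} (∈-filter⁺ (y ℚₚ.≤?_) y∈L ℚₚ.≤-refl)) (ℕₚ.m≤m+n _ 0)
length*2<sum-weight {y = y} {S ∷ _} y≤B (rejects ∷ rejectsNL) y∈L =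
  ℕₚ.+-mono-≤ (2≤sum-itemWeight {xs = large y S} y≤B rejects) (length*2<sum-weight y≤B rejectsNL y∈L)

sum-map-≤ : ∀ {A : Set} {f : A → ℕ} {a xs} → All (λ x → f x ℕ.≤ a) xs →
            sum (map f xs) ℕ.≤ length xs ℕ.* a
sum-map-≤ []             = z≤n
sum-map-≤ (fx≤a ∷ fxs≤a) = ℕₚ.+-mono-≤ fx≤a (sum-map-≤ fxs≤a)

m<n⇒2[m+1]+1≤3n : ∀ {m n} → m ℕ.< n → 2 ℕ.* (m ℕ.+ 1) ℕ.+ 1 ℕ.≤ 3 ℕ.* n
m<n⇒2[m+1]+1≤3n {m} {n} m<n = begin
  2 ℕ.* (m ℕ.+ 1) ℕ.+ 1  ≤⟨ ℕₚ.+-mono-≤ (ℕₚ.*-monoʳ-≤ 2 (subst (ℕ._≤ n) (ℕₚ.+-comm 1 m) m<n))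
                                         (ℕₚ.≤-trans (s≤s z≤n) m<n) ⟩
  2 ℕ.* n ℕ.+ n          ≡⟨ ℕₚ.+-comm (2 ℕ.* n) n ⟩
  3 ℕ.* n                ∎
  where open ℕₚ.≤-Reasoning

ffd-bound-large-opener : ∀ {B y NL L Ts} → y ≤ B → B < 3 · y → 0ℚ ≤ y → All (Rejects B y) NL → y ∈ L →
                         Feasible B Ts → All (All (0ℚ ≤_)) Ts → concat (NL ++ [ L ]) ↭ concat Ts →
                         2 ℕ.* length (NL ++ [ L ]) ℕ.+ 1 ℕ.≤ 3 ℕ.* length Ts
ffd-bound-large-opener {B} {y} {NL} {L} {Ts} y≤B B<3y y≥0 rejects y∈L feasible Ts≥0 D↭Ts
  rewrite List.length-++ NL {[ L ]} =
  m<n⇒2[m+1]+1≤3n (ℕₚ.*-cancelʳ-< 2 (length NL) (length Ts) (begin-strict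
    length NL ℕ.* 2                       <⟨ length*2<sum-weight y≤B rejects y∈L ⟩
    sum (map (weight B y) (NL ++ [ L ]))  ≡⟨ weight-concat B y (NL ++ [ L ]) ⟨
    weight B y (concat (NL ++ [ L ]))     ≡⟨ weight-↭ B y D↭Ts ⟩
    weight B y (concat Ts)                ≡⟨ weight-concat B y Ts ⟩
    sum (map (weight B y) Ts)             ≤⟨ sum-map-≤ (All.zipWith (λ (T≥0 , T≤B) → weight≤2 B<3y y≥0 T≥0 T≤B)
                                                                    (Ts≥0 , feasible)) ⟩
    length Ts ℕ.* 2                       ∎))
  where open ℕₚ.≤-Reasoning

-- Opener at most B/3: costs

Heavy : ℚ → List ℚ → Set
Heavy B S = 2 · B ≤ 3 · cost S

overflow⇒Heavy : ∀ {B y S} → 3 · y ≤ B → B < cost S + y → Heavy B S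
overflow⇒Heavy {B} {y} {S} 3y≤B B<S+y = ℚₚ.<⇒≤ (+-cancelˡ-< B (begin-strict
  B + 2 · B            ≡⟨⟩
  3 · B                <⟨ ·-monoʳ-< 2 B<S+y ⟩
  3 · (cost S + y)     ≡⟨ ×-distrib-+ (cost S) y 3 ⟩
  3 · cost S + 3 · y   ≤⟨ ℚₚ.+-monoʳ-≤ (3 · cost S) 3y≤B ⟩
  3 · cost S + B       ≡⟨ ℚₚ.+-comm (3 · cost S) B ⟩
  B + 3 · cost S       ∎))
  where open ℚₚ.≤-Reasoning

All-overflow⇒Heavy : ∀ {B y Ss} → 3 · y ≤ B → All (λ S → B < cost S + y) Ss → All (Heavy B) Ss
All-overflow⇒Heavy {B} {y} 3y≤B = All.map (λ {S} → overflow⇒Heavy {B} {y} {S} 3y≤B)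

-- The solver sees n · B through its unfolding B + (⋯ + (B + 0ℚ)).
Heavy-totalCost : ∀ {B NL} → All (Heavy B) NL → suc (length NL) · (2 · B) + B ≤ 3 · (totalCost NL + B)
Heavy-totalCost {B} {NL} heavy = begin
  (2 · B + length NL · (2 · B)) + B  ≡⟨ solve 2 (λ b n → ((b :+ (b :+ con 0ℚ)) :+ n) :+ b
                                                      := n :+ (b :+ (b :+ (b :+ con 0ℚ))))
                                                refl B (length NL · (2 · B)) ⟩
  length NL · (2 · B) + 3 · B        ≤⟨ ℚₚ.+-monoˡ-≤ (3 · B) (totalCost-≥ {n = 3} heavy) ⟩
  3 · totalCost NL + 3 · B           ≡⟨ ×-distrib-+ (totalCost NL) B 3 ⟨
  3 · (totalCost NL + B)             ∎
  where open ℚₚ.≤-Reasoning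

Heavy-totalCost-< : ∀ {B NL} → 0ℚ < B → All (Heavy B) NL →
                    suc (length NL) · (2 · B) < 3 · (totalCost NL + B)
Heavy-totalCost-< {B} {NL} B>0 heavy = ℚₚ.<-≤-trans x<x+B (Heavy-totalCost heavy)
  where x = suc (length NL) · (2 · B)
        x<x+B : x < x + B
        x<x+B = subst (_< x + B) (ℚₚ.+-identityʳ x) (ℚₚ.+-monoʳ-< x B>0)

paired-Heavy-totalCost-< : ∀ {B a l NL} → B < a + l → All (Heavy B) NL →
                           suc (suc (suc (length NL))) · (2 · B) < 3 · ((a + (l + totalCost NL)) + B)
paired-Heavy-totalCost-< {B} {a} {l} {NL} B<a+l heavy = begin-strict
  2 · B + (2 · B + x)        ≡⟨ solve 2 (λ b x → (b :+ (b :+ con 0ℚ)) :+ ((b :+ (b :+ con 0ℚ)) :+ x)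
                                              := (b :+ (b :+ (b :+ con 0ℚ))) :+ (x :+ b))
                                       refl B x ⟩
  3 · B + (x + B)            <⟨ ℚₚ.+-mono-<-≤ (·-monoʳ-< 2 B<a+l) (Heavy-totalCost heavy) ⟩
  3 · (a + l) + 3 · (t + B)  ≡⟨ ×-distrib-+ (a + l) (t + B) 3 ⟨
  3 · ((a + l) + (t + B))    ≡⟨ cong (3 ·_) (solve 4 (λ a l t b → (a :+ l) :+ (t :+ b) := (a :+ (l :+ t)) :+ b)
                                                   refl a l t B) ⟩
  3 · ((a + (l + t)) + B)    ∎
  where open ℚₚ.≤-Reasoning
        t = totalCost NL
        x = suc (length NL) · (2 · B)

costs⇒count : ∀ {B D S Rest k} → 0ℚ ≤ B → D ↭ S ∷ Rest →
              suc (length Rest) · (2 · B) < 3 · (totalCost Rest + B) → totalCost Rest + B < k · B →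
              2 ℕ.* length D ℕ.+ 1 ℕ.≤ 3 ℕ.* k
costs⇒count {B} {D} {S} {Rest} {k} B≥0 D↭S∷Rest lower upper rewrite ↭-length D↭S∷Rest =
  subst (ℕ._≤ 3 ℕ.* k) (1+m*2≡2*m+1 (suc (length Rest))) (·-cancelˡ-< B≥0 (begin-strict
    (suc (length Rest) ℕ.* 2) · B  ≡⟨ ×-assocˡ B (suc (length Rest)) 2 ⟨
    suc (length Rest) · (2 · B)    <⟨ lower ⟩
    3 · (totalCost Rest + B)       ≤⟨ ·-monoʳ-≤ 3 (ℚₚ.<⇒≤ upper) ⟩
    3 · (k · B)                    ≡⟨ ×-assocˡ B 3 k ⟩
    (3 ℕ.* k) · B                  ∎))
  where open ℚₚ.≤-Reasoning
        1+m*2≡2*m+1 : ∀ m → suc (m ℕ.* 2) ≡ 2 ℕ.* m ℕ.+ 1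
        1+m*2≡2*m+1 = solve-∀

single-rest⇒count : ∀ {B D S L k} → 0ℚ ≤ B → 0ℚ ≤ cost L → D ↭ S ∷ L ∷ [] →
                    totalCost (L ∷ []) + B < k · B → 2 ℕ.* length D ℕ.+ 1 ℕ.≤ 3 ℕ.* k
single-rest⇒count {B} {D} {S} {L} {k} B≥0 L≥0 D↭S∷L upper rewrite ↭-length D↭S∷L =
  ℕₚ.≤-trans (ℕₚ.n≤1+n 5) (ℕₚ.*-monoʳ-≤ 3 1<k)
  where open ℚₚ.≤-Reasoning
        1<k : 1 ℕ.< k
        1<k = ·-cancelˡ-< B≥0 (begin-strict
          1 · B                   ≡⟨ ℚₚ.+-identityʳ B ⟩
          B                       ≡⟨ ℚₚ.+-identityˡ B ⟨
          0ℚ + B                  ≤⟨ ℚₚ.+-monoˡ-≤ B (cost-nonneg (L≥0 ∷ [])) ⟩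
          totalCost (L ∷ []) + B  <⟨ upper ⟩
          k · B                   ∎)

-- S is the last block; or S and the last block are the only blocks; or the
-- last block pairs with a third block S′ to exceed B.
ffd-bound-small-opener : ∀ {B y NL L S k} → 0ℚ < B → 0ℚ ≤ y → 3 · y ≤ B →
                         All (λ S → B < cost S + y) NL → y ≤ cost L → S ∈ NL ++ [ L ] →
                         (∀ {Rest} → NL ++ [ L ] ↭ S ∷ Rest → totalCost Rest + B < k · B) →
                         2 ℕ.* length (NL ++ [ L ]) ℕ.+ 1 ℕ.≤ 3 ℕ.* k
ffd-bound-small-opener {B} {y} {NL} {L} {S} {k} B>0 y≥0 3y≤B overflows y≤L S∈D rest<
  with ∈-++⁻ NL S∈D
... | inj₂ (here refl) =
  costs⇒count {k = k} (ℚₚ.<⇒≤ B>0) D↭ (Heavy-totalCost-< B>0 heavyNL) (rest< D↭)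
  where D↭ = ↭-sym (∷↭∷ʳ L NL)
        heavyNL = All-overflow⇒Heavy {y = y} 3y≤B overflows
... | inj₁ S∈NL with ∈⇒↭∷ S∈NL
...   | [] , NL↭S = single-rest⇒count {k = k} (ℚₚ.<⇒≤ B>0) (ℚₚ.≤-trans y≥0 y≤L) D↭ (rest< D↭)
  where D↭ = ++⁺ʳ [ L ] NL↭S
...   | S′ ∷ NL′ , NL↭S∷S′∷NL′ with All-resp-↭ NL↭S∷S′∷NL′ overflows
...     | _ ∷ S′-overflows ∷ overflowsNL′ =
  costs⇒count {k = k} (ℚₚ.<⇒≤ B>0) D↭
    (paired-Heavy-totalCost-< {a = cost S′} {cost L} pair heavyNL′) (rest< D↭)
  where D↭ = ↭-trans (++⁺ʳ [ L ] NL↭S∷S′∷NL′) (prep S (prep S′ (↭-sym (∷↭∷ʳ L NL′))))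
        pair = ℚₚ.<-≤-trans S′-overflows (ℚₚ.+-monoʳ-≤ (cost S′) y≤L)
        heavyNL′ = All-overflow⇒Heavy {y = y} 3y≤B overflowsNL′

Item : ℚ → ℚ → Set
Item B c = 0ℚ < c × c ≤ B

Items⇒nonneg : ∀ {B xs} → All (Item B) xs → All (0ℚ ≤_) xs
Items⇒nonneg = All.map (ℚₚ.<⇒≤ ∘ proj₁)

ffd-bound : ∀ {B X y NL L Ts S T} → All (Item B) X → concat (NL ++ [ L ]) ↭ X → IsPartition B X Ts →
            All (Rejects B y) NL → y ∈ L → S ∈ NL ++ [ L ] → T ∈ Ts → cost T < cost S →
            2 ℕ.* length (NL ++ [ L ]) ℕ.+ 1 ℕ.≤ 3 ℕ.* length Ts
ffd-bound {B} {X} {y} {NL} {L} {Ts} items D↭X (Ts↭X , feasible) rejects y∈L S∈D T∈Ts T<S =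
  by-size-of-opener (3 · y ℚₚ.≤? B)
  where
  D↭Ts = ↭-trans D↭X (↭-sym Ts↭X)
  itemsD = concat⁻ (All-resp-↭ (↭-sym D↭X) items)
  NL≥0 = All.map Items⇒nonneg (proj₁ (++⁻ NL itemsD))
  L≥0 = Items⇒nonneg (All.head (proj₂ (++⁻ NL itemsD)))
  Ts≥0 = All.map Items⇒nonneg (concat⁻ (All-resp-↭ (↭-sym Ts↭X) items))
  y-item : Item B y
  y-item = All.lookup items (∈-resp-↭ D↭X (∈-concat⁺′ y∈L (∈-++⁺ʳ NL (here refl))))
  D≡Ts : totalCost (NL ++ [ L ]) ≡ totalCost Ts
  D≡Ts = trans (sym (cost-concat (NL ++ [ L ]))) (trans (cost-↭ D↭Ts) (cost-concat Ts))
  by-size-of-opener : Dec (3 · y ≤ B) → 2 ℕ.* length (NL ++ [ L ]) ℕ.+ 1 ℕ.≤ 3 ℕ.* length Ts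
  by-size-of-opener (yes 3y≤B) =
    ffd-bound-small-opener {k = length Ts} (ℚₚ.<-≤-trans (proj₁ y-item) (proj₂ y-item))
      (ℚₚ.<⇒≤ (proj₁ y-item)) 3y≤B (All.zipWith (λ (S≥0 , r) → Rejects⇒overflow S≥0 r) (NL≥0 , rejects))
      (∈⇒≤cost L≥0 y∈L) S∈D (totalCost-rest-< feasible T∈Ts D≡Ts T<S)
  by-size-of-opener (no 3y≰B) =
    ffd-bound-large-opener (proj₂ y-item) (ℚₚ.≰⇒> 3y≰B) (ℚₚ.<⇒≤ (proj₁ y-item)) rejects y∈L
      feasible Ts≥0 D↭Ts

lemma5 : (B : ℚ) (X : List ℚ) → All (λ c → (0ℚ < c) × (c ≤ B)) X →
         (ys : List ℚ) → SortedDecreasing X ys →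
         (Ts : List (List ℚ)) → IsOptimalPartition B X Ts →
         (∃[ S ] ∃[ T ] ((S ∈ firstFit B ys) × (T ∈ Ts) × (cost T < cost S))) →
         2 ℕ.* length (firstFit B ys) ℕ.+ 1 ℕ.≤ 3 ℕ.* length Ts
lemma5 B X items ys (ys↭X , sorted) Ts (partition , _) (S , T , S∈D , T∈Ts , T<S)
  with firstFit-shape {B} (Items⇒nonneg (All-resp-↭ (↭-sym ys↭X) items)) sorted S∈D
... | y , NL , L , D≡ , rejects , y∈L =
  subst (λ D → 2 ℕ.* length D ℕ.+ 1 ℕ.≤ 3 ℕ.* length Ts) (sym D≡)
    (ffd-bound items D↭X partition rejects y∈L (subst (S ∈_) D≡ S∈D) T∈Ts T<S)
  where D↭X = subst (λ D → concat D ↭ X) D≡ (↭-trans (concat-firstFit B ys) ys↭X)
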